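{- Let $P \subseteq \mathbb{Z}^m$ be a rectangle, and let $R_1, R_2$ be rectangles in $\mathbb{Z}^m$ with $\mathbf{0} \in R_1 \subseteq R_2$. Then $R_1 \subseteq_{S,P} R_2$.
   Context: A rectangle in $\mathbb{Z}^m$ is a set of the form $\mathbb{Z}^m \cap \prod_{i=1}^m [a_i, b_i]$ with integers $a_i \leq b_i$. For a pixel set $P \subseteq \mathbb{Z}^m$ and finite sets $B_1, B_2 \subseteq \mathbb{Z}^m$ containing $\mathbf{0}$ (structuring elements), $B_1 \subseteq_{S,P} B_2$ means $B_1 \subseteq B_2$ and both: (+) for every $\mathbf{x} \in P$ and $\mathbf{b}_2 \in B_2$ with $\mathbf{x} + \mathbf{b}_2 \in P$ there is $\mathbf{b}_1 \in B_1$ with $\mathbf{x} + \mathbf{b}_1 \in P$ and $B_1 + (\mathbf{b}_2 - \mathbf{b}_1) \subseteq B_2$; (−) for every $\mathbf{x} \in P$ and $\mathbf{b}_2 \in B_2$ with $\mathbf{x} - \mathbf{b}_2 \in P$ there is $\mathbf{b}_1 \in B_1$ with $\mathbf{x} - \mathbf{b}_1 \in P$ and $B_1 + (\mathbf{b}_2 - \mathbf{b}_1) \subseteq B_2$. Here $A + \mathbf{v} = \{\mathbf{a} + \mathbf{v} : \mathbf{a} \in A\}$. -}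

module Defs where

open import Level using (0ℓ)
open import Data.Nat using (ℕ)
open import Data.Fin using (Fin)
open import Data.Integer using (ℤ; 0ℤ; _≤_) renaming (_+_ to _+ℤ_; _-_ to _-ℤ_)
open import Data.Product using (Σ; _×_; ∃-syntax)
open import Relation.Unary using (Pred; _∈_; _⊆_)

Pt : ℕ → Set
Pt m = Fin m → ℤ

PSet : ℕ → Set₁
PSet m = Pred (Pt m) 0ℓ

𝟎 : ∀ {m} → Pt m
𝟎 _ = 0ℤ

_⊕_ : ∀ {m} → Pt m → Pt m → Pt m
(x ⊕ y) i = x i +ℤ y i

_⊖_ : ∀ {m} → Pt m → Pt m → Pt m
(x ⊖ y) i = x i -ℤ y i

Box : ∀ {m} → Pt m → Pt m → PSet m
Box a b x = ∀ i → (a i ≤ x i) × (x i ≤ b i)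

IsRectangle : ∀ {m} → PSet m → Set
IsRectangle {m} R =
  Σ (Pt m) λ a → Σ (Pt m) λ b →
    (∀ i → a i ≤ b i) × (∀ x → (R x → Box a b x) × (Box a b x → R x))

translate : ∀ {m} → PSet m → Pt m → PSet m
translate A v y = ∃[ a ] (A a × y ≡' (a ⊕ v))
  where
  open import Relation.Binary.PropositionalEquality using () renaming (_≡_ to _≡'_)

_⊆[S,_]_ : ∀ {m} → PSet m → PSet m → PSet m → Set
_⊆[S,_]_ {m} B₁ P B₂ =
  (B₁ ⊆ B₂)
  × (∀ (x b₂ : Pt m) → x ∈ P → b₂ ∈ B₂ → (x ⊕ b₂) ∈ P →
       ∃[ b₁ ] (b₁ ∈ B₁ × (x ⊕ b₁) ∈ P × (translate B₁ (b₂ ⊖ b₁) ⊆ B₂)))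
  × (∀ (x b₂ : Pt m) → x ∈ P → b₂ ∈ B₂ → (x ⊖ b₂) ∈ P →
       ∃[ b₁ ] (b₁ ∈ B₁ × (x ⊖ b₁) ∈ P × (translate B₁ (b₂ ⊖ b₁) ⊆ B₂)))

-- Take b₁ to be b₂ clamped coordinatewise into R₁. The clamp of c into an
-- interval lies between c and every point t of that interval. With t = 𝟎 this
-- puts x ± b₁ between x and x ± b₂, hence in P; with t ∈ R₁ it puts the mirror
-- image t + b₂ − b₁ between t and b₂, hence in R₂. So beyond R₁ being a
-- rectangle, P and R₂ need only be closed under coordinatewise betweenness.
module Submission where

open import Defs
open import Data.Nat using (ℕ)
open import Data.Integer using (ℤ; 0ℤ; _≤_; -_; _⊓_; _⊔_)
  renaming (_+_ to _+ℤ_; _-_ to _-ℤ_)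
open import Data.Integer.Properties
  using (≤-refl; ≤-trans; ≤-total; +-monoʳ-≤; neg-mono-≤; +-identityʳ;
         i≤i⊔j; i⊓j≤j; ⊔-lub; i≤j⇒i⊔j≡j; i≥j⇒i⊔j≡i; i≤j⇒i⊓j≡i; i≥j⇒i⊓j≡j)
open import Data.Integer.Tactic.RingSolver using (solve-∀)
open import Data.Product using (_×_; _,_; proj₁; proj₂)
open import Data.Sum using (_⊎_; inj₁; inj₂)
open import Relation.Unary using (_∈_; _⊆_)
open import Relation.Binary.PropositionalEquality using (_≡_; refl)

Between : ℤ → ℤ → ℤ → Set
Between u w v = (u ≤ w × w ≤ v) ⊎ (v ≤ w × w ≤ u)

module _ {u w v : ℤ} where

  between-sym : Between u w v → Between v w u
  between-sym (inj₁ uwv) = inj₂ uwv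
  between-sym (inj₂ vwu) = inj₁ vwu

  between-+ˡ : ∀ s → Between u w v → Between (s +ℤ u) (s +ℤ w) (s +ℤ v)
  between-+ˡ s (inj₁ (u≤w , w≤v)) = inj₁ (+-monoʳ-≤ s u≤w , +-monoʳ-≤ s w≤v)
  between-+ˡ s (inj₂ (v≤w , w≤u)) = inj₂ (+-monoʳ-≤ s v≤w , +-monoʳ-≤ s w≤u)

  between-neg : Between u w v → Between (- u) (- w) (- v)
  between-neg (inj₁ (u≤w , w≤v)) = inj₂ (neg-mono-≤ w≤v , neg-mono-≤ u≤w)
  between-neg (inj₂ (v≤w , w≤u)) = inj₁ (neg-mono-≤ w≤u , neg-mono-≤ v≤w)

  between-convex : ∀ {p q} → (p ≤ u × u ≤ q) → (p ≤ v × v ≤ q) →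
                   Between u w v → p ≤ w × w ≤ q
  between-convex (p≤u , _) (_ , v≤q) (inj₁ (u≤w , w≤v)) = ≤-trans p≤u u≤w , ≤-trans w≤v v≤q
  between-convex (_ , u≤q) (p≤v , _) (inj₂ (v≤w , w≤u)) = ≤-trans p≤v v≤w , ≤-trans w≤u u≤q

between-resp : ∀ {u u′ w w′ v v′} → u ≡ u′ → w ≡ w′ → v ≡ v′ →
               Between u w v → Between u′ w′ v′
between-resp refl refl refl h = h

between-right : ∀ u v → Between u v v
between-right u v with ≤-total u v
... | inj₁ u≤v = inj₁ (u≤v , ≤-refl)
... | inj₂ v≤u = inj₂ (≤-refl , v≤u)

between-offset : ∀ {w v} s → Between 0ℤ w v → Between s (s +ℤ w) (s +ℤ v)
between-offset s h = between-resp (+-identityʳ s) refl refl (between-+ˡ s h)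

between-mirror : ∀ {u w v} → Between u w v → Between u (u +ℤ (v -ℤ w)) v
-- The reflection z ↦ (u + v) − z swaps u and v.
between-mirror {u} {w} {v} h =
  between-sym (between-resp (cancelˡ u v) (reassoc u v w) (cancelʳ u v)
                            (between-+ˡ (u +ℤ v) (between-neg h)))
  where
  cancelˡ : ∀ a b → (a +ℤ b) -ℤ a ≡ b
  cancelˡ = solve-∀
  cancelʳ : ∀ a b → (a +ℤ b) -ℤ b ≡ a
  cancelʳ = solve-∀
  reassoc : ∀ a b c → (a +ℤ b) -ℤ c ≡ a +ℤ (b -ℤ c)
  reassoc = solve-∀

clamp : ℤ → ℤ → ℤ → ℤ
clamp lo hi c = lo ⊔ (c ⊓ hi)

clamp-∈ : ∀ {lo hi} c → lo ≤ hi → lo ≤ clamp lo hi c × clamp lo hi c ≤ hi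
clamp-∈ {lo} {hi} c lo≤hi = i≤i⊔j lo (c ⊓ hi) , ⊔-lub lo≤hi (i⊓j≤j c hi)

clamp-between : ∀ {lo hi t} c → lo ≤ t × t ≤ hi → Between t (clamp lo hi c) c
clamp-between {lo} {hi} {t} c (lo≤t , t≤hi) with ≤-total c hi
... | inj₂ hi≤c rewrite i≥j⇒i⊓j≡j hi≤c | i≤j⇒i⊔j≡j (≤-trans lo≤t t≤hi) =
  inj₁ (t≤hi , hi≤c)
... | inj₁ c≤hi rewrite i≤j⇒i⊓j≡i c≤hi with ≤-total lo c
...   | inj₁ lo≤c rewrite i≤j⇒i⊔j≡j lo≤c = between-right t c
...   | inj₂ c≤lo rewrite i≥j⇒i⊔j≡i c≤lo = inj₂ (c≤lo , lo≤t)

Betweenᵖ : ∀ {m} → Pt m → Pt m → Pt m → Set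
Betweenᵖ u w v = ∀ i → Between (u i) (w i) (v i)

BoxConvex : ∀ {m} → PSet m → Set
BoxConvex A = ∀ {u v w} → u ∈ A → v ∈ A → Betweenᵖ u w v → w ∈ A

box-boxConvex : ∀ {m} (a b : Pt m) → BoxConvex (Box a b)
box-boxConvex a b u∈ v∈ uwv i = between-convex (u∈ i) (v∈ i) (uwv i)

rectangle-boxConvex : ∀ {m} {R : PSet m} → IsRectangle R → BoxConvex R
rectangle-boxConvex (a , b , _ , R⇔box) {u} {v} {w} u∈R v∈R uwv =
  proj₂ (R⇔box w) (box-boxConvex a b (proj₁ (R⇔box u) u∈R) (proj₁ (R⇔box v) v∈R) uwv)

boxConvex⇒⊆[S] : ∀ {m} {P R₁ R₂ : PSet m} → BoxConvex P → BoxConvex R₂ →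
                 IsRectangle R₁ → 𝟎 ∈ R₁ → R₁ ⊆ R₂ → R₁ ⊆[S, P ] R₂
boxConvex⇒⊆[S] {m} {P} {R₁} {R₂} convP convR₂ (a , b , a≤b , R₁⇔box) 𝟎∈R₁ R₁⊆R₂ =
  R₁⊆R₂
  , (λ x c x∈P c∈R₂ x+c∈P →
       β c , β∈R₁ c ,
       convP x∈P x+c∈P (λ i → between-offset (x i) (β-between c 𝟎∈R₁ i)) ,
       translate-β c c∈R₂)
  , (λ x c x∈P c∈R₂ x-c∈P →
       β c , β∈R₁ c ,
       convP x∈P x-c∈P (λ i → between-offset (x i) (between-neg (β-between c 𝟎∈R₁ i))) ,
       translate-β c c∈R₂)
  where
  β : Pt m → Pt m
  β c i = clamp (a i) (b i) (c i)

  β∈R₁ : ∀ c → β c ∈ R₁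
  β∈R₁ c = proj₂ (R₁⇔box (β c)) λ i → clamp-∈ (c i) (a≤b i)

  β-between : ∀ {t} c → t ∈ R₁ → Betweenᵖ t (β c) c
  β-between {t} c t∈R₁ i = clamp-between (c i) (proj₁ (R₁⇔box t) t∈R₁ i)

  translate-β : ∀ c → c ∈ R₂ → translate R₁ (c ⊖ β c) ⊆ R₂
  translate-β c c∈R₂ (t , t∈R₁ , refl) =
    convR₂ (R₁⊆R₂ t∈R₁) c∈R₂ λ i → between-mirror (β-between c t∈R₁ i)

theorem1 : (m : ℕ) (P R₁ R₂ : PSet m) →
    IsRectangle P → IsRectangle R₁ → IsRectangle R₂ →
    𝟎 ∈ R₁ → R₁ ⊆ R₂ →
    R₁ ⊆[S, P ] R₂
theorem1 m P R₁ R₂ P-rect R₁-rect R₂-rect =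
  boxConvex⇒⊆[S] (rectangle-boxConvex P-rect) (rectangle-boxConvex R₂-rect) R₁-rect
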